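{- Let $D\ge2$ and consider a $D$-shallow instance of $k$-DST. Let $(x,f,y)$ be a feasible solution of LP-k-DST* with $Q$ replaced by $Q_D$, and define $\hat x$ on the edges of the tree $\mathcal{G}$ by $\hat x_{\{p,p+e\}}:=y_{p+e}$ for every $p+e\in Q_D$. Then $\sum_{e'\in E(\mathcal{G})} c_{e'}\hat x_{e'}\le k^{D-2}\sum_{e\in E(G)} c_e x_e$.
   Context: An instance of $k$-DST consists of a directed graph $G$ with nonnegative edge costs $\{c_e\}$, a root $r$, terminals $T=\{t_1,\dots,t_h\}\subseteq V(G)$ and an integer $k\ge1$; a feasible solution is a subgraph containing $k$ pairwise edge-disjoint directed $r,t$-paths for every $t\in T$. The instance is $D$-shallow if it has an optimal solution $H^*$ such that for each $t\in T$, $H^*$ has $k$ edge-disjoint $r,t$-paths each of length (number of edges) at most $D$. Let $Q_D$ be the set of directed paths in $G$ starting at $r$ of length at most $D$ (including the trivial path $(r)$); $Q_D(v)$ those ending at vertex $v$; $Q_\ell(e)$ the paths starting at $r$ of length at most $\ell$ whose last edge is $e$; for $q,p$ starting at $r$, $q\subseteq p$ means $q$ is an initial subpath of $p$; $p+e$ denotes the path $p$ extended by the edge $e$. LP-k-DST* with $Q$ replaced by $Q_D$ has variables $x_e$, $f^i_p$ ($p\in Q_D(t_i)$), $y_q$ ($q\in Q_D$): minimize $\sum_e c_ex_e$ subject to $\sum_{p\in Q_D(t_i):e\in E(p)}f^i_p\le x_e$; $\sum_{p\in Q_D(t_i)}f^i_p\ge k$; $\sum_{p\in Q_D(t_i):q\subseteq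 p}f^i_p\le y_q$ for all $q\in Q_D$, $t_i$; $\sum_{p\in Q_\ell(e)\cap Q_D}y_p\le\max\{1,k^{\ell-2}\}x_e$ for all $e$, $\ell\ge1$; $0\le x_e\le1$; $f,y\ge0$. The tree $\mathcal{G}$ has vertex set $Q_D$, an edge $\{p,p+e\}$ whenever $p,p+e\in Q_D$, with cost $c_{\{p,p+e\}}=c_e$.
   Formalization: The edge costs $c_e$ and the values of the LP solution $(x,f,y)$ are rational. -}

module Defs where

open import Data.Bool using (Bool; true; false; _∧_; not)
open import Data.Nat as ℕ using (ℕ; zero; suc; _∸_; _^_; _⊔_)
open import Data.Fin using (Fin)
open import Data.Fin.Properties using (_≟_)
open import Data.Integer using (+_)
open import Data.List using (List; []; _∷_; _++_; [_]; map; concatMap; filterᵇ; allFin; upTo; length; foldr)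
open import Data.Bool.ListAction using (any)
open import Data.Maybe using (Maybe; just; nothing)
open import Data.Product using (Σ; _×_; _,_; proj₁; proj₂)
open import Data.Rational as ℚ using (ℚ; 0ℚ; 1ℚ; _+_; _*_; _/_)
open import Data.List.Membership.Propositional using (_∈_)
open import Relation.Nullary.Decidable using (⌊_⌋)
open import Relation.Nullary using (¬_)
open import Data.Unit using (⊤)
open import Relation.Binary.PropositionalEquality using (_≡_)

toℚ : ℕ → ℚ
toℚ n = (+ n) / 1

sumℚ : List ℚ → ℚ
sumℚ = foldr _+_ 0ℚ

-- A finite directed (multi)graph: vertices Fin n, edges Fin m,
-- edge e goes from (tl e) to (hd e).

record Digraph : Set where
  field
    n  : ℕ
    m  : ℕ
    tl : Fin m → Fin n
    hd : Fin m → Fin n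

open Digraph public

module _ (G : Digraph) where

  Vtx : Set
  Vtx = Fin (n G)

  Edge : Set
  Edge = Fin (m G)

  Path : Set
  Path = List Edge

  eqV : Vtx → Vtx → Bool
  eqV u v = ⌊ u ≟ v ⌋

  eqE : Edge → Edge → Bool
  eqE e e' = ⌊ e ≟ e' ⌋

  chainFrom : Vtx → Path → Bool
  chainFrom v []       = true
  chainFrom v (e ∷ es) = eqV (tl G e) v ∧ chainFrom (hd G e) es

  vertsFrom : Vtx → Path → List Vtx
  vertsFrom v []       = v ∷ []
  vertsFrom v (e ∷ es) = v ∷ vertsFrom (hd G e) es

  endFrom : Vtx → Path → Vtx
  endFrom v []       = v
  endFrom v (e ∷ es) = endFrom (hd G e) es

  distinctV : List Vtx → Bool
  distinctV []       = true
  distinctV (v ∷ vs) = not (any (eqV v) vs) ∧ distinctV vs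

  isPathFrom : Vtx → Path → Bool
  isPathFrom r p = chainFrom r p ∧ distinctV (vertsFrom r p)

  isPath : Vtx → Vtx → Path → Bool
  isPath r t p = isPathFrom r p ∧ eqV (endFrom r p) t

  memE : Edge → Path → Bool
  memE e p = any (eqE e) p

  lastEdge : Path → Maybe Edge
  lastEdge []           = nothing
  lastEdge (e ∷ [])     = just e
  lastEdge (_ ∷ e ∷ es) = lastEdge (e ∷ es)

  isLastEdge : Edge → Path → Bool
  isLastEdge e p with lastEdge p
  ... | nothing = false
  ... | just e' = eqE e e'

  -- q ⊆ p : q is an initial subpath of p
  isPrefix : Path → Path → Bool
  isPrefix []       p        = true
  isPrefix (_ ∷ _)  []       = false
  isPrefix (e ∷ q)  (e' ∷ p) = eqE e e' ∧ isPrefix q p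

  seqsOfLength : ℕ → List Path
  seqsOfLength zero    = [] ∷ []
  seqsOfLength (suc ℓ) = concatMap (λ p → map (λ e → p ++ [ e ]) (allFin (m G))) (seqsOfLength ℓ)

  seqsUpTo : ℕ → List Path
  seqsUpTo D = concatMap seqsOfLength (upTo (suc D))

  -- Q_D : directed paths starting at r of length ≤ D (incl. trivial path)
  Q : Vtx → ℕ → List Path
  Q r D = filterᵇ (isPathFrom r) (seqsUpTo D)

  Qto : Vtx → ℕ → Vtx → List Path
  Qto r D v = filterᵇ (λ p → eqV (endFrom r p) v) (Q r D)

  QlastD : Vtx → ℕ → ℕ → Edge → List Path
  QlastD r D ℓ e = filterᵇ (λ p → ⌊ length p ℕ.≤? ℓ ⌋ ∧ isLastEdge e p) (Q r D)

  -- Edges of the tree 𝒢 on vertex set Q_D: pairs (p , e) standing for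
  -- the tree edge {p , p+e}, whenever p ∈ Q_D and p+e ∈ Q_D.
  memPath : Path → List Path → Bool
  memPath p ps = any (eqPath p) ps
    where
    eqPath : Path → Path → Bool
    eqPath []       []        = true
    eqPath (e ∷ p)  (e' ∷ p') = eqE e e' ∧ eqPath p p'
    eqPath _        _         = false

  treeEdges : Vtx → ℕ → List (Path × Edge)
  treeEdges r D =
    concatMap (λ p → map (λ e → (p , e))
                          (filterᵇ (λ e → memPath (p ++ [ e ]) (Q r D)) (allFin (m G))))
              (Q r D)

  Subgraph : Set
  Subgraph = Edge → Bool

  costOf : (Edge → ℚ) → Subgraph → ℚ
  costOf c H = sumℚ (map c (filterᵇ H (allFin (m G))))

  LenOK : Path → Maybe ℕ → Set
  LenOK p nothing  = ⊤
  LenOK p (just D) = length p ℕ.≤ D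

  -- H contains k pairwise edge-disjoint directed r,t-paths, each of
  -- length at most `bound` (bound = nothing means no length bound)
  record DisjointPaths (H : Subgraph) (k : ℕ) (r t : Vtx) (bound : Maybe ℕ) : Set where
    field
      paths    : Fin k → Path
      isRT     : ∀ j → isPath r t (paths j) ≡ true
      inH      : ∀ j e → memE e (paths j) ≡ true → H e ≡ true
      disjoint : ∀ j j' → ¬ (j ≡ j') → ∀ e → memE e (paths j) ≡ true → memE e (paths j') ≡ false
      short    : ∀ j → LenOK (paths j) bound

  Feasible : ∀ {h} → ℕ → Vtx → (Fin h → Vtx) → Subgraph → Set
  Feasible k r T H = ∀ i → DisjointPaths H k r (T i) nothing

  Shallow : ∀ {h} → (Edge → ℚ) → ℕ → Vtx → (Fin h → Vtx) → ℕ → Set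
  Shallow c k r T D =
    Σ Subgraph λ H* →
      Feasible k r T H*
      × (∀ H → Feasible k r T H → costOf c H* ℚ.≤ costOf c H)
      × (∀ i → DisjointPaths H* k r (T i) (just D))

  record LPFeasible {h} (k : ℕ) (r : Vtx) (T : Fin h → Vtx) (D : ℕ)
                    (x : Edge → ℚ) (f : Fin h → Path → ℚ) (y : Path → ℚ) : Set where
    field
      capacity : ∀ i e →
        sumℚ (map (f i) (filterᵇ (memE e) (Qto r D (T i)))) ℚ.≤ x e
      demand   : ∀ i →
        toℚ k ℚ.≤ sumℚ (map (f i) (Qto r D (T i)))
      prefixY  : ∀ q → q ∈ Q r D → ∀ i →
        sumℚ (map (f i) (filterᵇ (isPrefix q) (Qto r D (T i)))) ℚ.≤ y q
      depth    : ∀ e ℓ → 1 ℕ.≤ ℓ →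
        sumℚ (map y (QlastD r D ℓ e)) ℚ.≤ toℚ (1 ⊔ k ^ (ℓ ∸ 2)) * x e
      x≥0      : ∀ e → 0ℚ ℚ.≤ x e
      x≤1      : ∀ e → x e ℚ.≤ 1ℚ
      f≥0      : ∀ i p → p ∈ Qto r D (T i) → 0ℚ ℚ.≤ f i p
      y≥0      : ∀ q → q ∈ Q r D → 0ℚ ℚ.≤ y q

module Submission where

-- Every edge {p , p+e} of the tree 𝒢 has cost c_e·y_{p+e}; it is the unique tree
-- edge entering the path q = p+e, and q is a path of Q_D whose last edge is e.
-- Hence the cost of 𝒢 is at most Σ_e c_e · Σ_{q ∈ Q_D, last edge e} y_q, and the
-- depth constraint of the LP with ℓ = D bounds each inner sum by k^(D-2)·x_e.
--
-- The reindexing "tree edge (p , e) ↦ path p+e" is done layer by layer: the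
-- sequences of length L+1 are by definition the one-edge extensions of those of
-- length L, so the cost of the tree edges below layer L is at most the charge of
-- layer L+1; layer D has no children in Q_D and layer 0 has nonnegative charge.

open import Defs
open import Data.Nat using (ℕ; _≤_; _∸_; _^_)
open import Data.Fin using (Fin)
open import Data.List using (map; allFin; _++_; [_])
open import Data.Product using (_,_)
open import Data.Rational as ℚ using (ℚ; 0ℚ; _*_)

open import Algebra.Bundles using (CommutativeMonoid)
open import Data.Nat using (zero; suc; _<_; _⊔_; z≤n; s≤s; s≤s⁻¹)
import Data.Nat.Properties as ℕP
open import Data.Rational using (_+_)
import Data.Rational.Properties as ℚP
open import Data.List using (List; []; _∷_; _∷ʳ_; concatMap; filterᵇ; applyUpTo; upTo; length)
open import Data.List.Properties using (map-∘; applyUpTo-∷ʳ; length-++)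
open import Data.List.Membership.Propositional using (_∈_; find; lose)
open import Data.List.Membership.Propositional.Properties
  using (∈-concatMap⁺; ∈-concatMap⁻; ∈-map⁺; ∈-map⁻; ∈-filter⁺; ∈-filter⁻; ∈-upTo⁺; ∈-upTo⁻; ∈-allFin)
open import Data.List.Relation.Unary.Any using (here; there)
open import Data.Bool using (Bool; true; false; _∧_; _∨_; if_then_else_)
open import Data.Bool.Properties using (∧-conicalˡ; ∧-conicalʳ; T-≡)
open import Data.Maybe using (just)
open import Data.Fin.Properties using (_≟_)
open import Data.Product using (_×_; proj₁; proj₂)
open import Data.Sum using (_⊎_; inj₁; inj₂)
open import Data.Empty using (⊥-elim)
open import Relation.Nullary using (yes; no)
open import Relation.Nullary.Decidable using (⌊_⌋; T?; fromWitness)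
open import Relation.Binary.PropositionalEquality
  using (_≡_; refl; sym; trans; cong; cong₂; subst; module ≡-Reasoning)
open import Function using (_∘_; id; Equivalence)

open import Algebra.Properties.CommutativeSemigroup
  (CommutativeMonoid.commutativeSemigroup ℚP.+-0-commutativeMonoid)
  using (interchange)
open import Algebra.Properties.CommutativeSemigroup
  (CommutativeMonoid.commutativeSemigroup ℚP.*-1-commutativeMonoid)
  using (x∙yz≈y∙xz)

if-elim : (b : Bool) {u v : ℚ} (R : ℚ → Set) →
          (b ≡ true → R u) → (b ≡ false → R v) → R (if b then u else v)
if-elim true  R onTrue onFalse = onTrue refl
if-elim false R onTrue onFalse = onFalse refl

if-true : (b : Bool) {u v : ℚ} → b ≡ true → (if b then u else v) ≡ u
if-true true refl = refl

if-nonneg : (b : Bool) {u : ℚ} → 0ℚ ℚ.≤ u → 0ℚ ℚ.≤ (if b then u else 0ℚ)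
if-nonneg b 0≤u = if-elim b (0ℚ ℚ.≤_) (λ _ → 0≤u) (λ _ → ℚP.≤-refl)

*-nonneg : ∀ {a b} → 0ℚ ℚ.≤ a → 0ℚ ℚ.≤ b → 0ℚ ℚ.≤ a * b
*-nonneg {a} {b} 0≤a 0≤b =
  ℚP.nonNegative⁻¹ (a * b)
    {{ℚP.nonNeg*nonNeg⇒nonNeg a {{ℚ.nonNegative 0≤a}} b {{ℚ.nonNegative 0≤b}}}}

module _ {a} {A : Set a} where

  sum-++ : ∀ (g : A → ℚ) xs ys →
           sumℚ (map g (xs ++ ys)) ≡ sumℚ (map g xs) + sumℚ (map g ys)
  sum-++ g []       ys = sym (ℚP.+-identityˡ _)
  sum-++ g (x ∷ xs) ys =
    trans (cong (g x +_) (sum-++ g xs ys)) (sym (ℚP.+-assoc (g x) _ _))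

  sum-filter : ∀ (P : A → Bool) (g : A → ℚ) xs →
    sumℚ (map g (filterᵇ P xs)) ≡ sumℚ (map (λ a → if P a then g a else 0ℚ) xs)
  sum-filter P g [] = refl
  sum-filter P g (x ∷ xs) with P x
  ... | true  = cong (g x +_) (sum-filter P g xs)
  ... | false = trans (sum-filter P g xs) (sym (ℚP.+-identityˡ _))

  sum-cong : ∀ {g h : A → ℚ} → (∀ a → g a ≡ h a) → ∀ xs →
             sumℚ (map g xs) ≡ sumℚ (map h xs)
  sum-cong g≡h []       = refl
  sum-cong g≡h (x ∷ xs) = cong₂ _+_ (g≡h x) (sum-cong g≡h xs)

  sum-zero : ∀ (xs : List A) → sumℚ (map (λ _ → 0ℚ) xs) ≡ 0ℚ
  sum-zero []       = refl
  sum-zero (x ∷ xs) = trans (ℚP.+-identityˡ _) (sum-zero xs)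

  sum-+ : ∀ (g h : A → ℚ) xs →
          sumℚ (map (λ a → g a + h a) xs) ≡ sumℚ (map g xs) + sumℚ (map h xs)
  sum-+ g h []       = sym (ℚP.+-identityˡ _)
  sum-+ g h (x ∷ xs) =
    trans (cong (g x + h x +_) (sum-+ g h xs))
          (interchange (g x) (h x) (sumℚ (map g xs)) (sumℚ (map h xs)))

  sum-scale : ∀ c (g : A → ℚ) xs →
              c * sumℚ (map g xs) ≡ sumℚ (map (λ a → c * g a) xs)
  sum-scale c g []       = ℚP.*-zeroʳ c
  sum-scale c g (x ∷ xs) =
    trans (ℚP.*-distribˡ-+ c (g x) _) (cong (c * g x +_) (sum-scale c g xs))

  sum-mono : ∀ {g h : A → ℚ} xs → (∀ a → a ∈ xs → g a ℚ.≤ h a) →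
             sumℚ (map g xs) ℚ.≤ sumℚ (map h xs)
  sum-mono []       g≤h = ℚP.≤-refl
  sum-mono (x ∷ xs) g≤h =
    ℚP.+-mono-≤ (g≤h x (here refl)) (sum-mono xs (λ a a∈ → g≤h a (there a∈)))

  sum-nonneg : ∀ {g : A → ℚ} xs → (∀ a → a ∈ xs → 0ℚ ℚ.≤ g a) →
               0ℚ ℚ.≤ sumℚ (map g xs)
  sum-nonneg xs 0≤g =
    ℚP.≤-trans (ℚP.≤-reflexive (sym (sum-zero xs))) (sum-mono xs 0≤g)

  term≤sum : ∀ {g : A → ℚ} xs {b} → b ∈ xs → (∀ a → a ∈ xs → 0ℚ ℚ.≤ g a) →
             g b ℚ.≤ sumℚ (map g xs)
  term≤sum {g} (x ∷ xs) (here refl) 0≤g =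
    ℚP.≤-trans (ℚP.≤-reflexive (sym (ℚP.+-identityʳ (g x))))
      (ℚP.+-monoʳ-≤ (g x) (sum-nonneg xs (λ a a∈ → 0≤g a (there a∈))))
  term≤sum {g} (x ∷ xs) (there b∈) 0≤g =
    ℚP.≤-trans (term≤sum xs b∈ (λ a a∈ → 0≤g a (there a∈)))
      (ℚP.≤-trans (ℚP.≤-reflexive (sym (ℚP.+-identityˡ _)))
        (ℚP.+-monoˡ-≤ (sumℚ (map g xs)) (0≤g x (here refl))))

module _ {a b} {A : Set a} {B : Set b} where

  sum-map : ∀ (g : B → ℚ) (f : A → B) xs →
            sumℚ (map g (map f xs)) ≡ sumℚ (map (g ∘ f) xs)
  sum-map g f xs = cong sumℚ (sym (map-∘ xs))

  sum-concatMap : ∀ (g : B → ℚ) (f : A → List B) xs →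
    sumℚ (map g (concatMap f xs)) ≡ sumℚ (map (λ a → sumℚ (map g (f a))) xs)
  sum-concatMap g f []       = refl
  sum-concatMap g f (x ∷ xs) =
    trans (sum-++ g (f x) (concatMap f xs)) (cong (sumℚ (map g (f x)) +_) (sum-concatMap g f xs))

  sum-swap : ∀ (g : A → B → ℚ) xs ys →
    sumℚ (map (λ a → sumℚ (map (g a) ys)) xs)
      ≡ sumℚ (map (λ b → sumℚ (map (λ a → g a b) xs)) ys)
  sum-swap g []       ys = sym (sum-zero ys)
  sum-swap g (x ∷ xs) ys =
    trans (cong (sumℚ (map (g x) ys) +_) (sum-swap g xs ys))
          (sym (sum-+ (g x) (λ b → sumℚ (map (λ a → g a b) xs)) ys))

sum-applyUpTo-shift : ∀ (U V : ℕ → ℚ) f n →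
  (∀ i → i < n → U (f i) ℚ.≤ V (f (suc i))) →
  sumℚ (map U (applyUpTo f n)) ℚ.≤ sumℚ (map V (applyUpTo (f ∘ suc) n))
sum-applyUpTo-shift U V f zero    U≤V = ℚP.≤-refl
sum-applyUpTo-shift U V f (suc n) U≤V =
  ℚP.+-mono-≤ (U≤V 0 (s≤s z≤n))
    (sum-applyUpTo-shift U V (f ∘ suc) n (λ i i<n → U≤V (suc i) (s≤s i<n)))

layers-shift : ∀ (U V : ℕ → ℚ) D →
  (∀ L → L < D → U L ℚ.≤ V (suc L)) → U D ℚ.≤ 0ℚ → 0ℚ ℚ.≤ V 0 →
  sumℚ (map U (upTo (suc D))) ℚ.≤ sumℚ (map V (upTo (suc D)))
layers-shift U V D U≤V UD≤0 0≤V0 = begin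
  sumℚ (map U (upTo (suc D)))               ≡⟨ cong (sumℚ ∘ map U) (sym (applyUpTo-∷ʳ id D)) ⟩
  sumℚ (map U (upTo D ∷ʳ D))                ≡⟨ sum-++ U (upTo D) [ D ] ⟩
  sumℚ (map U (upTo D)) + (U D + 0ℚ)        ≤⟨ ℚP.+-mono-≤ (sum-applyUpTo-shift U V id D U≤V)
                                                 (ℚP.≤-trans (ℚP.≤-reflexive (ℚP.+-identityʳ (U D))) UD≤0) ⟩
  ΣV₊ + 0ℚ                                  ≡⟨ trans (ℚP.+-identityʳ ΣV₊) (sym (ℚP.+-identityˡ ΣV₊)) ⟩
  0ℚ + ΣV₊                                  ≤⟨ ℚP.+-monoˡ-≤ ΣV₊ 0≤V0 ⟩
  sumℚ (map V (upTo (suc D)))               ∎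
  where
  open ℚP.≤-Reasoning
  ΣV₊ = sumℚ (map V (applyUpTo suc D))

-- a one-element membership test unfolds to  b ∨ false
∨false-true : ∀ {b} → b ∨ false ≡ true → b ≡ true
∨false-true {true} _ = refl

true-∨false : ∀ {b} → b ≡ true → b ∨ false ≡ true
true-∨false refl = refl

∨-true : ∀ {a b} → a ∨ b ≡ true → a ∨ false ≡ true ⊎ b ≡ true
∨-true {true}  _      = inj₁ refl
∨-true {false} b≡true = inj₂ b≡true

length-snoc : ∀ {A : Set} (p : List A) e → length (p ++ [ e ]) ≡ suc (length p)
length-snoc p e = trans (length-++ p) (ℕP.+-comm (length p) 1)

module _ (G : Digraph) where

  eqE-refl : ∀ e → eqE G e e ≡ true
  eqE-refl e with e ≟ e
  ... | yes _ = refl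
  ... | no e≢e = ⊥-elim (e≢e refl)

  eqE-sound : ∀ {e e'} → eqE G e e' ≡ true → e ≡ e'
  eqE-sound {e} {e'} eq with e ≟ e'
  ... | yes e≡e' = e≡e'

  lastEdge-snoc : ∀ (p : Path G) e → lastEdge G (p ++ [ e ]) ≡ just e
  lastEdge-snoc []          e = refl
  lastEdge-snoc (_ ∷ [])    e = refl
  lastEdge-snoc (_ ∷ e' ∷ p) e = lastEdge-snoc (e' ∷ p) e

  isLastEdge-snoc : ∀ p e → isLastEdge G e (p ++ [ e ]) ≡ true
  isLastEdge-snoc p e rewrite lastEdge-snoc p e = eqE-refl e

  memPath-single : ∀ (q p : Path G) → memPath G q (p ∷ []) ≡ true → q ≡ p
  memPath-single []      []       _  = refl
  memPath-single (e ∷ q) (e' ∷ p) eq =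
    cong₂ _∷_ (eqE-sound (∧-conicalˡ _ _ (∨false-true eq)))
              (memPath-single q p (true-∨false (∧-conicalʳ _ _ (∨false-true eq))))

  memPath-sound : ∀ (q : Path G) ps → memPath G q ps ≡ true → q ∈ ps
  memPath-sound q (p ∷ ps) eq with ∨-true eq
  ... | inj₁ q≡p  = here (memPath-single q p q≡p)
  ... | inj₂ q∈ps = there (memPath-sound q ps q∈ps)

  extensions : Path G → List (Path G)
  extensions p = map (λ e → p ++ [ e ]) (allFin (m G))

  extension∈seqsOfLength : ∀ L p e → p ∈ seqsOfLength G L →
                            p ++ [ e ] ∈ seqsOfLength G (suc L)
  extension∈seqsOfLength L p e p∈ =
    ∈-concatMap⁺ extensions (lose p∈ (∈-map⁺ (λ e → p ++ [ e ]) (∈-allFin e)))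

  seqsOfLength-length : ∀ L q → q ∈ seqsOfLength G L → length q ≡ L
  seqsOfLength-length zero    q (here refl) = refl
  seqsOfLength-length (suc L) q q∈ with find (∈-concatMap⁻ extensions {xs = seqsOfLength G L} q∈)
  ... | p , p∈ , q∈ext with ∈-map⁻ (λ e → p ++ [ e ]) q∈ext
  ... | e , _ , refl = trans (length-snoc p e) (cong suc (seqsOfLength-length L p p∈))

  seqsOfLength⊆seqsUpTo : ∀ D L q → L < suc D → q ∈ seqsOfLength G L → q ∈ seqsUpTo G D
  seqsOfLength⊆seqsUpTo D L q L≤D q∈ = ∈-concatMap⁺ (seqsOfLength G) (lose (∈-upTo⁺ L≤D) q∈)

  seqsUpTo-length : ∀ D q → q ∈ seqsUpTo G D → length q ≤ D
  seqsUpTo-length D q q∈ with find (∈-concatMap⁻ (seqsOfLength G) {xs = upTo (suc D)} q∈)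
  ... | L , L∈ , q∈L =
    subst (_≤ D) (sym (seqsOfLength-length L q q∈L)) (s≤s⁻¹ (∈-upTo⁻ L∈))

  Q-intro : ∀ r D q → q ∈ seqsUpTo G D → isPathFrom G r q ≡ true → q ∈ Q G r D
  Q-intro r D q q∈ isPath = ∈-filter⁺ (T? ∘ isPathFrom G r) q∈ (Equivalence.from T-≡ isPath)

  Q-elim : ∀ r D q → q ∈ Q G r D → q ∈ seqsUpTo G D × isPathFrom G r q ≡ true
  Q-elim r D q q∈ with ∈-filter⁻ (T? ∘ isPathFrom G r) {xs = seqsUpTo G D} q∈
  ... | q∈seqs , isPath = q∈seqs , Equivalence.to T-≡ isPath

module TreeCharging (G : Digraph) (c : Edge G → ℚ) (r : Vtx G) (D : ℕ) (y : Path G → ℚ)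
                    (c≥0 : ∀ e → 0ℚ ℚ.≤ c e) (y≥0 : ∀ q → q ∈ Q G r D → 0ℚ ℚ.≤ y q) where

  Es : List (Edge G)
  Es = allFin (m G)

  QD : List (Path G)
  QD = Q G r D

  treeEdgeCost : Path G × Edge G → ℚ
  treeEdgeCost (p , e) = c e * y (p ++ [ e ])

  childCost : Path G → Edge G → ℚ
  childCost p e = if memPath G (p ++ [ e ]) QD then c e * y (p ++ [ e ]) else 0ℚ

  costBelow : Path G → ℚ
  costBelow p = sumℚ (map (childCost p) Es)

  -- q is charged c_e·y_q through its last edge e (the filter defining Q_D(e) with ℓ = D)
  endsWith : Edge G → Path G → Bool
  endsWith e q = ⌊ length q Data.Nat.≤? D ⌋ ∧ isLastEdge G e q

  chargeVia : Path G → Edge G → ℚ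
  chargeVia q e = if endsWith e q then c e * y q else 0ℚ

  charge : Path G → ℚ
  charge q = sumℚ (map (chargeVia q) Es)

  onPaths : (Path G → ℚ) → Path G → ℚ
  onPaths g q = if isPathFrom G r q then g q else 0ℚ

  layer : (Path G → ℚ) → ℕ → ℚ
  layer g L = sumℚ (map (onPaths g) (seqsOfLength G L))

  sum-QD-by-layers : ∀ g → sumℚ (map g QD) ≡ sumℚ (map (layer g) (upTo (suc D)))
  sum-QD-by-layers g =
    trans (sum-filter (isPathFrom G r) g (seqsUpTo G D))
          (sum-concatMap (onPaths g) (seqsOfLength G) (upTo (suc D)))

  charge-nonneg : ∀ q → q ∈ seqsUpTo G D → 0ℚ ℚ.≤ onPaths charge q
  charge-nonneg q q∈ = if-elim (isPathFrom G r q) (0ℚ ℚ.≤_)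
    (λ isPath → sum-nonneg Es (λ e _ → if-nonneg (endsWith e q)
                  (*-nonneg (c≥0 e) (y≥0 q (Q-intro G r D q q∈ isPath)))))
    (λ _ → ℚP.≤-refl)

  tree-cost-by-layers :
    sumℚ (map treeEdgeCost (treeEdges G r D)) ≡ sumℚ (map (layer costBelow) (upTo (suc D)))
  tree-cost-by-layers = begin
    sumℚ (map treeEdgeCost (treeEdges G r D))
      ≡⟨ sum-concatMap treeEdgeCost (λ p → map (p ,_) (children p)) QD ⟩
    sumℚ (map (λ p → sumℚ (map treeEdgeCost (map (p ,_) (children p)))) QD)
      ≡⟨ sum-cong (λ p → trans (sum-map treeEdgeCost (p ,_) (children p))
                               (sum-filter (λ e → memPath G (p ++ [ e ]) QD) _ Es)) QD ⟩
    sumℚ (map costBelow QD)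
      ≡⟨ sum-QD-by-layers costBelow ⟩
    sumℚ (map (layer costBelow) (upTo (suc D)))
      ∎
    where
    open ≡-Reasoning
    children : Path G → List (Edge G)
    children p = filterᵇ (λ e → memPath G (p ++ [ e ]) QD) Es

  top-layer-childless : layer costBelow D ℚ.≤ 0ℚ
  top-layer-childless =
    ℚP.≤-trans (sum-mono (seqsOfLength G D) costBelow≤0)
               (ℚP.≤-reflexive (sum-zero (seqsOfLength G D)))
    where
    childCost≤0 : ∀ p e → length p ≡ D → childCost p e ℚ.≤ 0ℚ
    childCost≤0 p e |p|≡D = if-elim (memPath G (p ++ [ e ]) QD) (ℚ._≤ 0ℚ)
      (λ p+e∈ → ⊥-elim (ℕP.n≮n D (subst (_≤ D) (trans (length-snoc p e) (cong suc |p|≡D))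
         (seqsUpTo-length G D (p ++ [ e ])
           (proj₁ (Q-elim G r D (p ++ [ e ]) (memPath-sound G (p ++ [ e ]) QD p+e∈)))))))
      (λ _ → ℚP.≤-refl)
    costBelow≤0 : ∀ p → p ∈ seqsOfLength G D → onPaths costBelow p ℚ.≤ 0ℚ
    costBelow≤0 p p∈ = if-elim (isPathFrom G r p) (ℚ._≤ 0ℚ)
      (λ _ → ℚP.≤-trans (sum-mono Es (λ e _ → childCost≤0 p e (seqsOfLength-length G D p p∈)))
                        (ℚP.≤-reflexive (sum-zero Es)))
      (λ _ → ℚP.≤-refl)

  childCost≤charge : ∀ p e → p ++ [ e ] ∈ seqsUpTo G D →
                     childCost p e ℚ.≤ onPaths charge (p ++ [ e ])
  childCost≤charge p e q∈seqs =
    if-elim (memPath G q QD) (ℚ._≤ onPaths charge q) charged (λ _ → charge-nonneg q q∈seqs)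
    where
    q = p ++ [ e ]
    charged : memPath G q QD ≡ true → c e * y q ℚ.≤ onPaths charge q
    charged q∈? = begin
      c e * y q     ≡⟨ sym (if-true (endsWith e q) ends) ⟩
      chargeVia q e ≤⟨ term≤sum Es (∈-allFin e)
                         (λ e' _ → if-nonneg (endsWith e' q) (*-nonneg (c≥0 e') (y≥0 q q∈QD))) ⟩
      charge q      ≡⟨ sym (if-true (isPathFrom G r q) (proj₂ (Q-elim G r D q q∈QD))) ⟩
      onPaths charge q ∎
      where
      open ℚP.≤-Reasoning
      q∈QD = memPath-sound G q QD q∈?
      ends : endsWith e q ≡ true
      ends = cong₂ _∧_ (Equivalence.to T-≡ (fromWitness
                          (seqsUpTo-length G D q (proj₁ (Q-elim G r D q q∈QD)))))
                       (isLastEdge-snoc G p e)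

  below≤charge : ∀ L → L < D → layer costBelow L ℚ.≤ layer charge (suc L)
  below≤charge L L<D = begin
    layer costBelow L
      ≤⟨ sum-mono (seqsOfLength G L) perPath ⟩
    sumℚ (map (λ p → sumℚ (map (λ e → onPaths charge (p ++ [ e ])) Es)) (seqsOfLength G L))
      ≡⟨ sym (trans (sum-concatMap (onPaths charge) (extensions G) (seqsOfLength G L))
                    (sum-cong (λ p → sum-map (onPaths charge) (λ e → p ++ [ e ]) Es)
                              (seqsOfLength G L))) ⟩
    layer charge (suc L)
      ∎
    where
    open ℚP.≤-Reasoning
    perPath : ∀ p → p ∈ seqsOfLength G L →
              onPaths costBelow p ℚ.≤ sumℚ (map (λ e → onPaths charge (p ++ [ e ])) Es)
    perPath p p∈ = if-elim (isPathFrom G r p) (ℚ._≤ sumℚ (map (λ e → onPaths charge (p ++ [ e ])) Es))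
      (λ _ → sum-mono Es (λ e _ → childCost≤charge p e (p+e∈ e)))
      (λ _ → sum-nonneg Es (λ e _ → charge-nonneg (p ++ [ e ]) (p+e∈ e)))
      where
      p+e∈ : ∀ e → p ++ [ e ] ∈ seqsUpTo G D
      p+e∈ e = seqsOfLength⊆seqsUpTo G D (suc L) (p ++ [ e ]) (s≤s L<D)
                 (extension∈seqsOfLength G L p e p∈)

  charge-by-last-edge :
    sumℚ (map (layer charge) (upTo (suc D)))
      ≡ sumℚ (map (λ e → c e * sumℚ (map y (QlastD G r D D e))) Es)
  charge-by-last-edge = begin
    sumℚ (map (layer charge) (upTo (suc D)))   ≡⟨ sym (sum-QD-by-layers charge) ⟩
    sumℚ (map charge QD)                       ≡⟨ sum-swap chargeVia QD Es ⟩
    sumℚ (map (λ e → sumℚ (map (λ q → chargeVia q e) QD)) Es)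
      ≡⟨ sum-cong (λ e → sym (trans (sum-scale (c e) y (QlastD G r D D e))
                                    (sum-filter (endsWith e) (λ q → c e * y q) QD))) Es ⟩
    sumℚ (map (λ e → c e * sumℚ (map y (QlastD G r D D e))) Es) ∎
    where open ≡-Reasoning

  tree-cost≤charge :
    sumℚ (map treeEdgeCost (treeEdges G r D))
      ℚ.≤ sumℚ (map (λ e → c e * sumℚ (map y (QlastD G r D D e))) Es)
  tree-cost≤charge = begin
    sumℚ (map treeEdgeCost (treeEdges G r D))   ≡⟨ tree-cost-by-layers ⟩
    sumℚ (map (layer costBelow) (upTo (suc D)))
      ≤⟨ layers-shift (layer costBelow) (layer charge) D below≤charge top-layer-childless
           (sum-nonneg (seqsOfLength G 0)
             (λ q q∈ → charge-nonneg q (seqsOfLength⊆seqsUpTo G D 0 q (s≤s z≤n) q∈))) ⟩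
    sumℚ (map (layer charge) (upTo (suc D)))   ≡⟨ charge-by-last-edge ⟩
    sumℚ (map (λ e → c e * sumℚ (map y (QlastD G r D D e))) Es) ∎
    where open ℚP.≤-Reasoning

depth-factor : ∀ k D → 1 ≤ k → 1 ⊔ k ^ (D ∸ 2) ≡ k ^ (D ∸ 2)
depth-factor k D 1≤k = ℕP.m≤n⇒m⊔n≡n (ℕP.m^n>0 k {{Data.Nat.>-nonZero 1≤k}} (D ∸ 2))

charge-via-edge≤ : ∀ (G : Digraph) (c : Edge G → ℚ) r {h} (T : Fin h → Vtx G) k D
  (x : Edge G → ℚ) (f : Fin h → Path G → ℚ) (y : Path G → ℚ) →
  LPFeasible G k r T D x f y → 1 ≤ k → 1 ≤ D → ∀ e → 0ℚ ℚ.≤ c e →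
  c e * sumℚ (map y (QlastD G r D D e)) ℚ.≤ toℚ (k ^ (D ∸ 2)) * (c e * x e)
charge-via-edge≤ G c r T k D x f y lp 1≤k 1≤D e 0≤ce = begin
  c e * sumℚ (map y (QlastD G r D D e))
    ≤⟨ ℚP.*-monoˡ-≤-nonNeg (c e) {{ℚ.nonNegative 0≤ce}} depth ⟩
  c e * (toℚ (k ^ (D ∸ 2)) * x e)
    ≡⟨ x∙yz≈y∙xz (c e) (toℚ (k ^ (D ∸ 2))) (x e) ⟩
  toℚ (k ^ (D ∸ 2)) * (c e * x e) ∎
  where
  open ℚP.≤-Reasoning
  depth : sumℚ (map y (QlastD G r D D e)) ℚ.≤ toℚ (k ^ (D ∸ 2)) * x e
  depth = subst (λ n → sumℚ (map y (QlastD G r D D e)) ℚ.≤ toℚ n * x e)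
                (depth-factor k D 1≤k) (LPFeasible.depth lp e D 1≤D)

lemma8 : (G : Digraph) (c : Edge G → ℚ) (r : Vtx G) {h : ℕ} (T : Fin h → Vtx G)
    (k D : ℕ) → 1 ≤ k → 2 ≤ D →
    (∀ e → 0ℚ ℚ.≤ c e) →
    Shallow G c k r T D →
    (x : Edge G → ℚ) (f : Fin h → Path G → ℚ) (y : Path G → ℚ) →
    LPFeasible G k r T D x f y →
    sumℚ (map (λ { (p , e) → c e * y (p ++ [ e ]) }) (treeEdges G r D))
    ℚ.≤ toℚ (k ^ (D ∸ 2)) * sumℚ (map (λ e → c e * x e) (allFin (m G)))
lemma8 G c r T k D 1≤k 2≤D c≥0 _ x f y lp = begin
  sumℚ (map treeEdgeCost (treeEdges G r D))
    ≤⟨ tree-cost≤charge ⟩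
  sumℚ (map (λ e → c e * sumℚ (map y (QlastD G r D D e))) Es)
    ≤⟨ sum-mono Es (λ e _ → charge-via-edge≤ G c r T k D x f y lp 1≤k 1≤D e (c≥0 e)) ⟩
  sumℚ (map (λ e → toℚ (k ^ (D ∸ 2)) * (c e * x e)) Es)
    ≡⟨ sym (sum-scale (toℚ (k ^ (D ∸ 2))) (λ e → c e * x e) Es) ⟩
  toℚ (k ^ (D ∸ 2)) * sumℚ (map (λ e → c e * x e) Es) ∎
  where
  open ℚP.≤-Reasoning
  open TreeCharging G c r D y c≥0 (LPFeasible.y≥0 lp)
  1≤D : 1 ≤ D
  1≤D = ℕP.≤-trans (s≤s z≤n) 2≤D
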